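{- For every integer $n\geq 3$, the graph $R_n$ is a rooted directed path graph.
   Context: For $n\geq 3$, the graph $R_n$ has $4n$ vertices $\bigcup_{i=1}^n\{a_i,b_i,c_i,d_i\}$, and its edges are defined by declaring its maximal cliques to be $C_i=\{a_i,b_i,c_i,d_i\}$ for $1\le i\le n$ and $C'_i=\{a_j\mid i\le j\le n\}\cup\{b_i,b_{i+1},c_i\}$ for $1\le i\le n-1$ (two vertices are adjacent iff they lie in a common one of these sets). A graph is a rooted directed path graph if it admits an intersection model consisting of directed paths in an arborescence (a directed rooted tree in which every edge points away from the root). -}

module Defs where

open import Data.Nat using (ℕ; zero; suc; _≤_; _<_)
open import Data.Fin using (Fin; toℕ; inject₁) renaming (suc to fsuc)
open import Data.Product using (Σ; _×_; _,_)
open import Data.Sum using (_⊎_)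
open import Relation.Nullary using (¬_)
open import Relation.Binary.PropositionalEquality using (_≡_; _≢_)
open import Relation.Binary.Construct.Closure.ReflexiveTransitive using (Star)
open import Function.Bundles using (_⇔_)

record Arborescence (m : ℕ) : Set₁ where
  field
    root       : Fin m
    Edge       : Fin m → Fin m → Set
    root-noIn  : ∀ u → ¬ Edge u root
    parent     : ∀ v → v ≢ root → Σ (Fin m) (λ u → Edge u v)
    parent-uniq : ∀ u u′ v → Edge u v → Edge u′ v → u ≡ u′
    reachable  : ∀ v → Star Edge root v

record DirPath {m : ℕ} (T : Arborescence m) : Set where
  field
    len  : ℕ
    node : Fin (suc len) → Fin m
    step : ∀ (i : Fin len) → Arborescence.Edge T (node (inject₁ i)) (node (fsuc i))

_∈P_ : {m : ℕ} {T : Arborescence m} → Fin m → DirPath T → Set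
t ∈P P = Σ (Fin (suc (DirPath.len P))) (λ i → DirPath.node P i ≡ t)

IsRootedDirectedPathGraph : (V : Set) → (V → V → Set) → Set₁
IsRootedDirectedPathGraph V Adj =
  Σ ℕ λ m → Σ (Arborescence m) λ T → Σ (V → DirPath T) λ P →
    ∀ u v → u ≢ v → (Adj u v ⇔ Σ (Fin m) (λ t → (t ∈P P u) × (t ∈P P v)))

-- The graph R_n.  Index i : Fin n stands for the paper's index toℕ i + 1.

data Letter : Set where
  a b c d : Letter

RVertex : ℕ → Set
RVertex n = Fin n × Letter

-- Membership in C′_i (paper index toℕ i + 1, requiring toℕ i + 1 ≤ n - 1,
-- i.e. suc (toℕ i) < n):
--   {a_j | i ≤ j ≤ n} ∪ {b_i, b_{i+1}, c_i}
data InC′ {n : ℕ} (i : Fin n) : RVertex n → Set where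
  inA  : ∀ j → toℕ i ≤ toℕ j → InC′ i (j , a)
  inBi : InC′ i (i , b)
  inBs : ∀ j → toℕ j ≡ suc (toℕ i) → InC′ i (j , b)
  inC  : InC′ i (i , c)

-- Two vertices are adjacent iff they are distinct and lie in a common
-- maximal clique C_i = {a_i,b_i,c_i,d_i} or C′_i (1 ≤ i ≤ n-1).
RAdj : (n : ℕ) → RVertex n → RVertex n → Set
RAdj n (i , x) (j , y) =
  ((i , x) ≢ (j , y)) ×
  ((i ≡ j) ⊎ Σ (Fin n) (λ k → (suc (toℕ k) < n) × InC′ k (i , x) × InC′ k (j , y)))

-- The model tree is a comb: a spine C′₁ → C′₂ → … → C′ₙ₋₁ → • with one
-- leaf Cᵢ hanging below the i-th spine node.  Every vertex xᵢ is mapped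
-- to the path that runs down the spine over exactly the indices k for
-- which xᵢ ∈ C′ₖ and then turns into the leaf Cᵢ; these indices form an
-- interval ending at i (all of [1, i] for aᵢ, [i-1, i] for bᵢ, [i, i]
-- for cᵢ and none for dᵢ).  Two such paths meet either in a common
-- leaf, i.e. in some Cᵢ, or in a spine node C′ₖ containing both
-- vertices.  The extra spine node below C′ₙ₋₁ only meets paths of
-- vertices with index n.
module Submission where

open import Defs
open import Data.Nat using (ℕ; _≤_)
open import Data.Nat as ℕ using (zero; suc; _+_; _∸_; _<_; z≤n; s≤s; s≤s⁻¹; _<?_)
open import Data.Nat.Properties
open import Data.Nat.GeneralisedArithmetic using (fold)
open import Data.Fin using (Fin; toℕ; inject₁; pred; splitAt; _↑ˡ_; _↑ʳ_)
  renaming (zero to fzero; suc to fsuc)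
open import Data.Fin.Properties
  using (toℕ-injective; toℕ<n; toℕ-inject₁; toℕ-↑ˡ; toℕ-↑ʳ; ↑ˡ-injective; pred<;
         splitAt-↑ˡ; splitAt-↑ʳ; splitAt⁻¹-↑ˡ; splitAt⁻¹-↑ʳ)
open import Data.Fin.Induction using (<-wellFounded)
open import Data.Product using (Σ; ∃; _×_; _,_; proj₂)
open import Data.Sum using (_⊎_; inj₁; inj₂; [_,_]′)
open import Function using (_∘_)
open import Function.Bundles using (_⇔_; mk⇔; Equivalence)
open import Induction.WellFounded using (Acc; acc)
open import Relation.Nullary using (yes; no; contradiction)
open import Relation.Binary.PropositionalEquality
open import Relation.Binary.Construct.Closure.ReflexiveTransitive using (Star; ε; _◅_; _◅◅_)

infix 4 _∈[_,_]

_∈[_,_] : ℕ → ℕ → ℕ → Set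
k ∈[ s , e ] = s ≤ k × k ≤ e

module _ {m : ℕ} {T : Arborescence m} where
  open Arborescence T using (Edge)

  head : DirPath T → Fin m
  head P = DirPath.node P fzero

  trivialPath : Fin m → DirPath T
  trivialPath u = record { len = 0 ; node = λ _ → u ; step = λ () }

  cons : (u : Fin m) (P : DirPath T) → Edge u (head P) → DirPath T
  cons u P u→P = record { len = suc len ; node = node′ ; step = step′ }
    where
    open DirPath P
    node′ : Fin (suc (suc len)) → Fin m
    node′ fzero    = u
    node′ (fsuc i) = node i
    step′ : (i : Fin (suc len)) → Edge (node′ (inject₁ i)) (node′ (fsuc i))
    step′ fzero    = u→P
    step′ (fsuc i) = step i

  ∈-cons⁻ : ∀ {u t P} {u→P : Edge u (head P)} → t ∈P cons u P u→P → u ≡ t ⊎ t ∈P P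
  ∈-cons⁻ (fzero  , u≡t) = inj₁ u≡t
  ∈-cons⁻ (fsuc i , eq)  = inj₂ (i , eq)

  ∈-cons⁺ : ∀ {u t P} {u→P : Edge u (head P)} → t ∈P P → t ∈P cons u P u→P
  ∈-cons⁺ (i , eq) = fsuc i , eq

module ParentMap {m : ℕ} (parent : Fin (suc m) → Fin (suc m))
                 (parent-< : ∀ v → v ≢ fzero → toℕ (parent v) < toℕ v) where

  Edge : Fin (suc m) → Fin (suc m) → Set
  Edge u v = v ≢ fzero × parent v ≡ u

  reachable : ∀ v → Star Edge fzero v
  reachable v = go v (<-wellFounded v)
    where
    go : ∀ v → Acc Data.Fin._<_ v → Star Edge fzero v
    go v (acc rs) with v Data.Fin.≟ fzero
    ... | yes refl = ε
    ... | no v≢0   = go (parent v) (rs (parent-< v v≢0)) ◅◅ ((v≢0 , refl) ◅ ε)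

  tree : Arborescence (suc m)
  tree = record
    { root        = fzero
    ; Edge        = Edge
    ; root-noIn   = λ _ (0≢0 , _) → 0≢0 refl
    ; parent      = λ v v≢0 → parent v , v≢0 , refl
    ; parent-uniq = λ _ _ _ (_ , p≡u) (_ , p≡u′) → trans (sym p≡u) p≡u′
    ; reachable   = reachable
    }

  AvoidsRootBelow : Fin (suc m) → ℕ → Set
  AvoidsRootBelow v L = ∀ {l} → l < L → fold v parent l ≢ fzero

  mutual
    ancestry : ∀ v L → AvoidsRootBelow v L → DirPath tree
    ancestry v zero    _      = trivialPath v
    ancestry v (suc L) noRoot =
      cons (fold v parent (suc L)) (ancestry v L (noRoot ∘ m<n⇒m<1+n))
           (subst (Edge (fold v parent (suc L))) (sym (head-ancestry v L _))
                  (noRoot (n<1+n L) , refl))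

    head-ancestry : ∀ v L (noRoot : AvoidsRootBelow v L) → head (ancestry v L noRoot) ≡ fold v parent L
    head-ancestry v zero    _ = refl
    head-ancestry v (suc L) _ = refl

  ∈-ancestry⁻ : ∀ {v L t} {noRoot : AvoidsRootBelow v L} → t ∈P ancestry v L noRoot →
                ∃ λ l → l ≤ L × fold v parent l ≡ t
  ∈-ancestry⁻ {L = zero} (_ , v≡t) = 0 , z≤n , v≡t
  ∈-ancestry⁻ {L = suc L} t∈ with ∈-cons⁻ t∈
  ... | inj₁ eq = suc L , ≤-refl , eq
  ... | inj₂ t∈′ with ∈-ancestry⁻ t∈′
  ...   | l , l≤L , eq = l , m≤n⇒m≤1+n l≤L , eq

  ∈-ancestry⁺ : ∀ {v L l} {noRoot : AvoidsRootBelow v L} → l ≤ L → fold v parent l ∈P ancestry v L noRoot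
  ∈-ancestry⁺ {L = zero} z≤n = fzero , refl
  ∈-ancestry⁺ {L = suc L} l≤1+L with m≤n⇒m<n∨m≡n l≤1+L
  ... | inj₁ l<1+L = ∈-cons⁺ (∈-ancestry⁺ (s≤s⁻¹ l<1+L))
  ... | inj₂ refl  = fzero , refl

toℕ-pred : ∀ {N} (k : Fin N) → toℕ (pred k) ≡ ℕ.pred (toℕ k)
toℕ-pred fzero    = refl
toℕ-pred (fsuc k) = toℕ-inject₁ k

toℕ-fold-pred : ∀ {N} (k : Fin N) l → toℕ (fold k pred l) ≡ toℕ k ∸ l
toℕ-fold-pred k zero    = refl
toℕ-fold-pred k (suc l) = begin
  toℕ (pred (fold k pred l))  ≡⟨ toℕ-pred (fold k pred l) ⟩
  ℕ.pred (toℕ (fold k pred l)) ≡⟨ cong ℕ.pred (toℕ-fold-pred k l) ⟩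
  ℕ.pred (toℕ k ∸ l)          ≡⟨ pred[m∸n]≡m∸[1+n] (toℕ k) l ⟩
  toℕ k ∸ suc l               ∎
  where open ≡-Reasoning

1+l≤1+e∸s⇒e∸l∈[s,e] : ∀ {l e s} → suc l ≤ suc e ∸ s → e ∸ l ∈[ s , e ]
1+l≤1+e∸s⇒e∸l∈[s,e] {l} {e} {s} 1+l≤1+e∸s = m+n≤o⇒m≤o∸n s (subst (_≤ e) (+-comm l s) l+s≤e) , m∸n≤m e l
  where
  s≤e : s ≤ e
  s≤e = s≤s⁻¹ (m∸n≢0⇒n<m (λ eq → contradiction (subst (suc l ≤_) eq 1+l≤1+e∸s) λ ()))
  l+s≤e : l + s ≤ e
  l+s≤e = m≤o∸n⇒m+n≤o l s≤e (s≤s⁻¹ (subst (suc l ≤_) (+-∸-assoc 1 s≤e) 1+l≤1+e∸s))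

-- The comb: a spine 0 → 1 → … → N-1 with a leaf below each spine node.
module Comb (n : ℕ) where
  N : ℕ
  N = suc n

  spine leaf : Fin N → Fin (N + N)
  spine k = k ↑ˡ N
  leaf k  = N ↑ʳ k

  parent : Fin (N + N) → Fin (N + N)
  parent v = [ spine ∘ pred , spine ]′ (splitAt N v)

  parent-spine : ∀ k → parent (spine k) ≡ spine (pred k)
  parent-spine k = cong [ spine ∘ pred , spine ]′ (splitAt-↑ˡ N k N)

  parent-leaf : ∀ k → parent (leaf k) ≡ spine k
  parent-leaf k = cong [ spine ∘ pred , spine ]′ (splitAt-↑ʳ N N k)

  spine-or-leaf : ∀ v → (∃ λ k → spine k ≡ v) ⊎ (∃ λ k → leaf k ≡ v)
  spine-or-leaf v with splitAt N v in eq
  ... | inj₁ k = inj₁ (k , splitAt⁻¹-↑ˡ eq)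
  ... | inj₂ k = inj₂ (k , splitAt⁻¹-↑ʳ eq)

  spine≢leaf : ∀ {k k′} → spine k ≢ leaf k′
  spine≢leaf {k} {k′} eq
    with () ← trans (sym (splitAt-↑ˡ N k N)) (trans (cong (splitAt N) eq) (splitAt-↑ʳ N N k′))

  leaf-injective : ∀ {k k′} → leaf k ≡ leaf k′ → k ≡ k′
  leaf-injective {k} {k′} eq
    with refl ← trans (sym (splitAt-↑ʳ N N k)) (trans (cong (splitAt N) eq) (splitAt-↑ʳ N N k′)) = refl

  parent-< : ∀ v → v ≢ fzero → toℕ (parent v) < toℕ v
  parent-< v v≢0 with spine-or-leaf v
  ... | inj₁ (k , refl) = begin-strict
    toℕ (parent (spine k)) ≡⟨ cong toℕ (parent-spine k) ⟩
    toℕ (spine (pred k))   ≡⟨ toℕ-↑ˡ (pred k) N ⟩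
    toℕ (pred k)           <⟨ pred< k (v≢0 ∘ cong spine) ⟩
    toℕ k                  ≡⟨ toℕ-↑ˡ k N ⟨
    toℕ (spine k)          ∎
    where open ≤-Reasoning
  ... | inj₂ (k , refl) = begin-strict
    toℕ (parent (leaf k)) ≡⟨ cong toℕ (parent-leaf k) ⟩
    toℕ (spine k)         ≡⟨ toℕ-↑ˡ k N ⟩
    toℕ k                 <⟨ toℕ<n k ⟩
    N                     ≤⟨ m≤m+n N (toℕ k) ⟩
    N + toℕ k             ≡⟨ toℕ-↑ʳ N k ⟨
    toℕ (leaf k)          ∎
    where open ≤-Reasoning

  open ParentMap parent parent-< public using (tree; AvoidsRootBelow; ancestry; ∈-ancestry⁻; ∈-ancestry⁺)

  fold-parent-leaf : ∀ e l → fold (leaf e) parent (suc l) ≡ spine (fold e pred l)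
  fold-parent-leaf e zero    = parent-leaf e
  fold-parent-leaf e (suc l) = trans (cong parent (fold-parent-leaf e l)) (parent-spine (fold e pred l))

  leaf-avoidsRootBelow : ∀ s e → AvoidsRootBelow (leaf e) (suc (toℕ e) ∸ s)
  leaf-avoidsRootBelow s e {zero}  _  leaf≡0 = spine≢leaf (sym leaf≡0)
  leaf-avoidsRootBelow s e {suc l} l< eq     = m>n⇒m∸n≢0 l<e (begin
      toℕ e ∸ l                 ≡⟨ toℕ-fold-pred e l ⟨
      toℕ (fold e pred l)       ≡⟨ cong toℕ (↑ˡ-injective N _ fzero (trans (sym (fold-parent-leaf e l)) eq)) ⟩
      0                         ∎)
      where
      open ≡-Reasoning
      l<e : l < toℕ e
      l<e = s≤s⁻¹ (<-≤-trans l< (m∸n≤m (suc (toℕ e)) s))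

  -- The path from spine s down to spine e followed by leaf e (just the
  -- leaf when s > e).
  combPath : ℕ → Fin N → DirPath tree
  combPath s e = ancestry (leaf e) (suc (toℕ e) ∸ s) (leaf-avoidsRootBelow s e)

  ∈-combPath⁻ : ∀ {s e t} → t ∈P combPath s e →
                leaf e ≡ t ⊎ ∃ λ k → toℕ k ∈[ s , toℕ e ] × spine k ≡ t
  ∈-combPath⁻ {s} {e} t∈ with ∈-ancestry⁻ t∈
  ... | zero  , _   , eq = inj₁ eq
  ... | suc l , l≤L , eq =
    inj₂ (fold e pred l , subst (_∈[ s , toℕ e ]) (sym (toℕ-fold-pred e l)) (1+l≤1+e∸s⇒e∸l∈[s,e] l≤L) ,
          trans (sym (fold-parent-leaf e l)) eq)

  leaf∈combPath : ∀ s e → leaf e ∈P combPath s e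
  leaf∈combPath s e = ∈-ancestry⁺ {noRoot = leaf-avoidsRootBelow s e} z≤n

  spine∈combPath : ∀ {s e k} → toℕ k ∈[ s , toℕ e ] → spine k ∈P combPath s e
  spine∈combPath {s} {e} {k} (s≤k , k≤e) =
    subst (_∈P combPath s e) (trans (fold-parent-leaf e (toℕ e ∸ toℕ k)) (cong spine descend≡k))
          (∈-ancestry⁺ (begin
            suc (toℕ e ∸ toℕ k) ≡⟨ +-∸-assoc 1 k≤e ⟨
            suc (toℕ e) ∸ toℕ k ≤⟨ ∸-monoʳ-≤ (suc (toℕ e)) s≤k ⟩
            suc (toℕ e) ∸ s     ∎))
    where
    open ≤-Reasoning
    descend≡k : fold e pred (toℕ e ∸ toℕ k) ≡ k
    descend≡k = toℕ-injective (trans (toℕ-fold-pred e (toℕ e ∸ toℕ k)) (m∸[m∸n]≡n k≤e))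

  combPaths-meet⇔ : ∀ {s e s′ e′} →
    (Σ (Fin (N + N)) λ t → t ∈P combPath s e × t ∈P combPath s′ e′) ⇔
    (e ≡ e′ ⊎ ∃ λ k → toℕ k ∈[ s , toℕ e ] × toℕ k ∈[ s′ , toℕ e′ ])
  combPaths-meet⇔ {s} {e} {s′} {e′} = mk⇔ meet→ meet←
    where
    meet→ : (Σ (Fin (N + N)) λ t → t ∈P combPath s e × t ∈P combPath s′ e′) →
            e ≡ e′ ⊎ ∃ λ k → toℕ k ∈[ s , toℕ e ] × toℕ k ∈[ s′ , toℕ e′ ]
    meet→ (t , t∈ , t∈′) with ∈-combPath⁻ t∈ | ∈-combPath⁻ t∈′
    ... | inj₁ eq | inj₁ eq′ = inj₁ (leaf-injective (trans eq (sym eq′)))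
    ... | inj₁ eq | inj₂ (_ , _ , eq′) = contradiction (trans eq′ (sym eq)) spine≢leaf
    ... | inj₂ (_ , _ , eq) | inj₁ eq′ = contradiction (trans eq (sym eq′)) spine≢leaf
    ... | inj₂ (k , k∈ , eq) | inj₂ (k′ , k′∈ , eq′)
      with refl ← ↑ˡ-injective N k k′ (trans eq (sym eq′)) = inj₂ (k , k∈ , k′∈)
    meet← : e ≡ e′ ⊎ (∃ λ k → toℕ k ∈[ s , toℕ e ] × toℕ k ∈[ s′ , toℕ e′ ]) →
            Σ (Fin (N + N)) λ t → t ∈P combPath s e × t ∈P combPath s′ e′
    meet← (inj₁ refl)           = leaf e , leaf∈combPath s e , leaf∈combPath s′ e
    meet← (inj₂ (k , k∈ , k∈′)) = spine k , spine∈combPath k∈ , spine∈combPath k∈′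

-- xᵢ ∈ C′ₖ exactly for k ∈ [lowEnd x i, i]; for dᵢ the interval is empty.
lowEnd : Letter → ℕ → ℕ
lowEnd a i = 0
lowEnd b i = ℕ.pred i
lowEnd c i = i
lowEnd d i = suc i

InC′⇒∈[lowEnd,] : ∀ {N} {k i : Fin N} {x} → InC′ k (i , x) → toℕ k ∈[ lowEnd x (toℕ i) , toℕ i ]
InC′⇒∈[lowEnd,] (inA _ k≤i)  = z≤n , k≤i
InC′⇒∈[lowEnd,] inBi          = pred[n]≤n , ≤-refl
InC′⇒∈[lowEnd,] (inBs _ i≡1+k) rewrite i≡1+k = ≤-refl , n≤1+n _
InC′⇒∈[lowEnd,] inC           = ≤-refl , ≤-refl

∈[lowEnd,]⇒InC′ : ∀ {N} {k i : Fin N} x → toℕ k ∈[ lowEnd x (toℕ i) , toℕ i ] → InC′ k (i , x)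
∈[lowEnd,]⇒InC′ {i = i} a (_ , k≤i) = inA i k≤i
∈[lowEnd,]⇒InC′ {k = k} {i} b (i-1≤k , k≤i) with toℕ k ℕ.≟ toℕ i
... | yes k≡i with refl ← toℕ-injective k≡i = inBi
... | no  k≢i = inBs i (≤-antisym (≤-trans (≤-reflexive (sym (suc-pred (toℕ i) ⦃ i≢0 ⦄))) (s≤s i-1≤k)) k<i)
  where
  k<i = ≤∧≢⇒< k≤i k≢i
  i≢0 = ℕ.>-nonZero (≤-<-trans z≤n k<i)
∈[lowEnd,]⇒InC′ {k = k} {i} c (i≤k , k≤i) with refl ← toℕ-injective (≤-antisym k≤i i≤k) = inC
∈[lowEnd,]⇒InC′ d (1+i≤k , k≤i) = contradiction (≤-trans 1+i≤k k≤i) (n≮n _)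

-- The index n-1 (paper: n) carries no clique C′ₖ; a common index there forces i = j.
cliques⇔commonIndex : ∀ {N} {i j : Fin N} {x y} →
  (i ≡ j ⊎ Σ (Fin N) (λ k → (suc (toℕ k) < N) × InC′ k (i , x) × InC′ k (j , y))) ⇔
  (i ≡ j ⊎ ∃ λ k → toℕ k ∈[ lowEnd x (toℕ i) , toℕ i ] × toℕ k ∈[ lowEnd y (toℕ j) , toℕ j ])
cliques⇔commonIndex {N} {i} {j} {x} {y} = mk⇔ to from
  where
  CommonIndex : Set
  CommonIndex = ∃ λ k → toℕ k ∈[ lowEnd x (toℕ i) , toℕ i ] × toℕ k ∈[ lowEnd y (toℕ j) , toℕ j ]
  CommonClique : Set
  CommonClique = Σ (Fin N) (λ k → (suc (toℕ k) < N) × InC′ k (i , x) × InC′ k (j , y))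
  to : i ≡ j ⊎ CommonClique → i ≡ j ⊎ CommonIndex
  to (inj₁ i≡j)               = inj₁ i≡j
  to (inj₂ (k , _ , k∈ , k∈′)) = inj₂ (k , InC′⇒∈[lowEnd,] k∈ , InC′⇒∈[lowEnd,] k∈′)
  from : i ≡ j ⊎ CommonIndex → i ≡ j ⊎ CommonClique
  from (inj₁ i≡j) = inj₁ i≡j
  from (inj₂ (k , k∈ , k∈′)) with suc (toℕ k) <? N
  ... | yes k<N-1 = inj₂ (k , k<N-1 , ∈[lowEnd,]⇒InC′ x k∈ , ∈[lowEnd,]⇒InC′ y k∈′)
  ... | no  k≮N-1 = inj₁ (toℕ-injective (trans (top i (proj₂ k∈)) (sym (top j (proj₂ k∈′)))))
    where
    top : (w : Fin N) → toℕ k ≤ toℕ w → toℕ w ≡ toℕ k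
    top w k≤w = ≤-antisym (s≤s⁻¹ (≤-trans (toℕ<n w) (≮⇒≥ k≮N-1))) k≤w

R-isRootedDirectedPathGraph : ∀ n → IsRootedDirectedPathGraph (RVertex (suc n)) (RAdj (suc n))
R-isRootedDirectedPathGraph n = N + N , tree , vertexPath , adj⇔meet
  where
  open Comb n
  vertexPath : RVertex N → DirPath tree
  vertexPath (i , x) = combPath (lowEnd x (toℕ i)) i

  adj⇔meet : ∀ u v → u ≢ v → RAdj N u v ⇔ Σ (Fin (N + N)) (λ t → t ∈P vertexPath u × t ∈P vertexPath v)
  adj⇔meet (i , x) (j , y) u≢v = mk⇔
    (λ (_ , cliques) → Equivalence.from combPaths-meet⇔ (Equivalence.to cliques⇔commonIndex cliques))
    (λ meet → u≢v , Equivalence.from cliques⇔commonIndex (Equivalence.to combPaths-meet⇔ meet))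

mainTheorem3 : ∀ (n : ℕ) → 3 ≤ n → IsRootedDirectedPathGraph (RVertex n) (RAdj n)
mainTheorem3 (suc n) _ = R-isRootedDirectedPathGraph n
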